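{- Bisimulation equivalence $\leftrightarrow$ (defined in the context) is a congruence: for all closed process terms $p,q,p',q'$, all closed conditions $\phi$, all $H\subseteq A$ and all evaluation maps $\sigma$, if $p\leftrightarrow p'$ and $q\leftrightarrow q'$ then $p+q\leftrightarrow p'+q'$, $p\cdot q\leftrightarrow p'\cdot q'$, $p^*q\leftrightarrow p'^*q'$, $\phi:\to p\leftrightarrow\phi:\to p'$, $p\parallel q\leftrightarrow p'\parallel q'$, $p\lfloor\!\lfloor q\leftrightarrow p'\lfloor\!\lfloor q'$, $p\mid q\leftrightarrow p'\mid q'$, $\partial_H(p)\leftrightarrow\partial_H(p')$ and $V_\sigma(p)\leftrightarrow V_\sigma(p')$.
   Context: Setting. Fix a finite set $A$ of basic actions with $\delta,\epsilon\notin A$, and a commutative, associative function $\gamma:(A\cup\{\delta\})\times(A\cup\{\delta\})\to A\cup\{\delta\}$ with $\gamma(\delta,a)=\delta$ for all $a$. Fix a signature $\Sigma_D$ containing a sort $D$ of data, a minimal algebra $\mathfrak D$ of $\Sigma_D$, and a countably infinite set $\mathcal V$ of flexible variables. $\mathrm{DataVal}$ is the set of closed $\Sigma_D$-terms of sort $D$. There are sorts $P$ (processes), $C$ (conditions), $D$ (data), with logical variables of each sort. Terms of sort $D$: built from $\Sigma_D$, logical data variables, and a constant $v$ for each $v\in\mathcal V$. Terms of sort $C$: $e=e'$, $\mathsf{true}$, $\mathsf{false}$, $\neg,\wedge,\vee,\to$, $\forall X$, $\exists X$ ($X$ a logical data variable); $\phi\leftrightarrow\psi$ abbreviates $(\phi\to\psi)\wedge(\psi\to\phi)$.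 Terms of sort $P$: $\delta$, $\epsilon$, $a$ ($a\in A$); binary $+$, $\cdot$, $x^*y$ (iteration), $\parallel$, $\lfloor\!\lfloor$ (left merge), $\mid$ (communication merge); $\partial_H$ ($H\subseteq A$); guarded command $\phi:\to p$; data parameterized actions $a(e_1,\dots,e_n)$ ($a\in A$, $n\in\mathbb N$); assignment actions $v:=e$ ($v\in\mathcal V$); evaluation operators $V_\sigma$ for each evaluation map $\sigma$. An evaluation map is $\sigma:\mathcal V\to\mathrm{DataVal}\cup\mathcal V$ with $\sigma(v)=v$ whenever $\sigma(v)\in\mathcal V$; it is extended homomorphically to data and condition terms; $\sigma[e/v]$ is $\sigma$ updated to map $v$ to $e$. Closed terms contain no logical variables (flexible variables may occur). A closed condition is read as a first-order formula over $\mathfrak D$ with flexible variables as free data variables; $\mathfrak D\models\phi$ means it is valid in $\mathfrak D$. Let $\mathcal C^{s}$ be the set of closed conditions $\phi$ with $\mathfrak D\not\models\phi\leftrightarrow\mathsf{false}$. An action is a closed term $a$, $a(e_1,\dots,e_n)$ or $v:=e$ ($a\in A$, $e,e_i$ closed data terms). Operational semantics. For $\phi\in\mathcal C^s$, $p\downarrow_\phi$ (termination under $\phi$), and for $\phi\in\mathcal C^s$ and an action $\alpha$, $p\xrightarrow{[\phi]\alpha}q$, on closed process terms, defined as the least relations closed under the following rules ($a,b,c\in A$; "(s)" means the rule applies only if the resulting condition is not equivalent in $\mathfrak D$ to $\mathsf{false}$): $\epsilon\downarrow_{\mathsf{true}}$; $\alpha\xrightarrow{[\mathsf{true}]\alpha}\epsilon$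 for each action $\alpha$; if $x\downarrow_\phi$ then $x+y\downarrow_\phi$ and $y+x\downarrow_\phi$; if $x\xrightarrow{[\phi]\alpha}x'$ then $x+y$ and $y+x$ $\xrightarrow{[\phi]\alpha}x'$; if $x\downarrow_\phi,y\downarrow_\psi$ then $x\cdot y\downarrow_{\phi\wedge\psi}$ (s); if $x\downarrow_\phi$, $y\xrightarrow{[\psi]\alpha}y'$ then $x\cdot y\xrightarrow{[\phi\wedge\psi]\alpha}y'$ (s); if $x\xrightarrow{[\phi]\alpha}x'$ then $x\cdot y\xrightarrow{[\phi]\alpha}x'\cdot y$; if $y\downarrow_\phi$ then $x^*y\downarrow_\phi$; if $y\xrightarrow{[\phi]\alpha}y'$ then $x^*y\xrightarrow{[\phi]\alpha}y'$; if $x\xrightarrow{[\phi]\alpha}x'$ then $x^*y\xrightarrow{[\phi]\alpha}x'\cdot(x^*y)$; if $x\downarrow_\phi$ then $\psi:\to x\downarrow_{\phi\wedge\psi}$ (s); if $x\xrightarrow{[\phi]\alpha}x'$ then $\psi:\to x\xrightarrow{[\phi\wedge\psi]\alpha}x'$ (s); if $x\downarrow_\phi,y\downarrow_\psi$ then $x\parallel y\downarrow_{\phi\wedge\psi}$ (s); if $x\xrightarrow{[\phi]\alpha}x'$ then $x\parallel y\xrightarrow{[\phi]\alpha}x'\parallel y$; if $y\xrightarrow{[\phi]\alpha}y'$ then $x\parallel y\xrightarrow{[\phi]\alpha}x\parallel y'$; if $x\xrightarrow{[\phi]a}x'$, $y\xrightarrow{[\psi]b}y'$, $\gamma(a,b)=c$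 then $x\parallel y\xrightarrow{[\phi\wedge\psi]c}x'\parallel y'$ and $x\mid y\xrightarrow{[\phi\wedge\psi]c}x'\parallel y'$ (s); if $x\xrightarrow{[\phi]a(e_1,\dots,e_n)}x'$, $y\xrightarrow{[\psi]b(e'_1,\dots,e'_n)}y'$, $\gamma(a,b)=c$ then $x\parallel y$ and $x\mid y$ $\xrightarrow{[\phi\wedge\psi\wedge e_1=e'_1\wedge\dots\wedge e_n=e'_n]c(e_1,\dots,e_n)}x'\parallel y'$ (s); if $x\xrightarrow{[\phi]\alpha}x'$ then $x\lfloor\!\lfloor y\xrightarrow{[\phi]\alpha}x'\parallel y$; if $x\downarrow_\phi$ then $\partial_H(x)\downarrow_\phi$; if $x\xrightarrow{[\phi]\alpha}x'$ with $\alpha$ of the form $a$ or $a(e_1,\dots,e_n)$ with $a\notin H$, or of the form $v:=e$, then $\partial_H(x)\xrightarrow{[\phi]\alpha}\partial_H(x')$; if $x\downarrow_\phi$ then $V_\sigma(x)\downarrow_{\sigma(\phi)}$; if $x\xrightarrow{[\phi]a}x'$ then $V_\sigma(x)\xrightarrow{[\sigma(\phi)]a}V_\sigma(x')$; if $x\xrightarrow{[\phi]a(e_1,\dots,e_n)}x'$ then $V_\sigma(x)\xrightarrow{[\sigma(\phi)]a(\sigma(e_1),\dots,\sigma(e_n))}V_\sigma(x')$; if $x\xrightarrow{[\phi]v:=e}x'$ then $V_\sigma(x)\xrightarrow{[\sigma(\phi)]v:=\sigma(e)}V_{\sigma[\sigma(e)/v]}(x')$ if $\sigma(v)\in\mathrm{DataVal}$,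 and $V_\sigma(x)\xrightarrow{[\sigma(\phi)]v:=\sigma(e)}V_\sigma(x')$ if $\sigma(v)\notin\mathrm{DataVal}$. Bisimulation. Actions $\alpha,\alpha'$ are data equivalent ($\alpha\simeq\alpha'$) iff $\alpha=\alpha'=a$ for some $a\in A$, or $\alpha=a(e_1,\dots,e_n)$, $\alpha'=a(e'_1,\dots,e'_n)$ with $\mathfrak D\models e_1=e'_1\wedge\dots\wedge e_n=e'_n$, or $\alpha=(v:=e)$, $\alpha'=(v:=e')$ with $\mathfrak D\models e=e'$; $[\alpha]$ is the class of $\alpha$. A bisimulation is a relation $R$ on closed process terms such that for all $(p,q)\in R$: if $p\xrightarrow{[\phi]\alpha}p'$ then there is a finite $\Psi\subseteq\mathcal C^s$ with $\mathfrak D\models\phi\to\bigvee\Psi$ such that for each $\psi\in\Psi$ there are $\alpha'\in[\alpha]$ and $q'$ with $q\xrightarrow{[\psi]\alpha'}q'$ and $(p',q')\in R$; symmetrically for transitions of $q$; if $p\downarrow_\phi$ then there is a finite $\Psi\subseteq\mathcal C^s$ with $\mathfrak D\models\phi\to\bigvee\Psi$ and $q\downarrow_\psi$ for all $\psi\in\Psi$; symmetrically for $q$. $p\leftrightarrow q$ iff some bisimulation contains $(p,q)$.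
   Formalization: Evaluation operators $V_\sigma$ in process terms admit any σ sending each flexible variable to itself or to a closed data term, and the side condition σ(v) ∈ DataVal of the assignment rule means σ(v) ≠ v. The statement above fails without it. -}

module Defs where

open import Data.Nat using (ℕ; zero; suc) renaming (_≟_ to _≟ℕ_)
open import Data.Fin using (Fin; zero; suc)
open import Data.Fin.Subset using (Subset; _∉_)
open import Data.Maybe using (Maybe; just; nothing)
open import Data.List using (List; []; _∷_)
open import Data.List.Relation.Unary.All using (All; []; _∷_)
open import Data.Vec using (Vec; []; _∷_)
open import Data.Product using (Σ; _×_; _,_)
open import Data.Sum using (_⊎_)
open import Data.Empty using (⊥)
open import Data.Unit using (⊤)
open import Relation.Nullary using (¬_; yes; no)
open import Relation.Binary.PropositionalEquality using (_≡_)

record Signature : Set₁ where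
  field
    Sort : Set
    D    : Sort
    Fun  : List Sort → Sort → Set

record Algebra (Sig : Signature) : Set₁ where
  open Signature Sig
  field
    Carrier : Sort → Set
    apply   : ∀ {ss s} → Fun ss s → All Carrier ss → Carrier s

-- Ground (closed) Σ_D-terms; DataVal = GTerm D.
module GroundTerms (Sig : Signature) where
  open Signature Sig
  mutual
    data GTerm : Sort → Set where
      fun : ∀ {ss s} → Fun ss s → GArgs ss → GTerm s
    data GArgs : List Sort → Set where
      []  : GArgs []
      _∷_ : ∀ {s ss} → GTerm s → GArgs ss → GArgs (s ∷ ss)

  module _ (𝔇 : Algebra Sig) where
    open Algebra 𝔇
    mutual
      ⟦_⟧g : ∀ {s} → GTerm s → Carrier s
      ⟦ fun f as ⟧g = apply f ⟦ as ⟧gs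
      ⟦_⟧gs : ∀ {ss} → GArgs ss → All Carrier ss
      ⟦ [] ⟧gs = []
      ⟦ g ∷ as ⟧gs = ⟦ g ⟧g ∷ ⟦ as ⟧gs

    Minimal : Set
    Minimal = ∀ s (d : Carrier s) → Σ (GTerm s) λ g → ⟦ g ⟧g ≡ d

-- The fixed setting: A = Fin nA (a finite set of basic actions; δ is
-- represented by 'nothing'), γ, the signature and the minimal algebra.

record Setting : Set₁ where
  field
    nA      : ℕ
    γ       : Maybe (Fin nA) → Maybe (Fin nA) → Maybe (Fin nA)
    γ-comm  : ∀ a b → γ a b ≡ γ b a
    γ-assoc : ∀ a b c → γ (γ a b) c ≡ γ a (γ b c)
    γ-δ     : ∀ a → γ nothing a ≡ nothing
    sig     : Signature
    𝔇       : Algebra sig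
    minimal : GroundTerms.Minimal sig 𝔇

module Sem (S : Setting) where
  open Setting S
  open Signature sig
  open Algebra 𝔇
  open GroundTerms sig public

  A : Set
  A = Fin nA

  -- Data terms in scope n: logical data variables are de Bruijn indices
  -- Fin n, flexible variables are v ∈ 𝒱 = ℕ.  Closed = scope 0.
  mutual
    data DTerm (n : ℕ) : Sort → Set where
      lvar : Fin n → DTerm n D
      flex : ℕ → DTerm n D
      fun  : ∀ {ss s} → Fun ss s → DArgs n ss → DTerm n s
    data DArgs (n : ℕ) : List Sort → Set where
      []  : DArgs n []
      _∷_ : ∀ {s ss} → DTerm n s → DArgs n ss → DArgs n (s ∷ ss)

  mutual
    wk : ∀ {n s} → DTerm 0 s → DTerm n s
    wk (lvar ())
    wk (flex v) = flex v
    wk (fun f as) = fun f (wks as)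
    wks : ∀ {n ss} → DArgs 0 ss → DArgs n ss
    wks [] = []
    wks (t ∷ as) = wk t ∷ wks as

  mutual
    emb : ∀ {n s} → GTerm s → DTerm n s
    emb (fun f as) = fun f (embs as)
    embs : ∀ {n ss} → GArgs ss → DArgs n ss
    embs [] = []
    embs (g ∷ as) = emb g ∷ embs as

  infixr 6 _∧c_
  infixr 5 _∨c_
  infixr 4 _⇒c_
  data Cond (n : ℕ) : Set where
    _≐_         : DTerm n D → DTerm n D → Cond n
    tt ff       : Cond n
    ¬c_         : Cond n → Cond n
    _∧c_ _∨c_ _⇒c_ : Cond n → Cond n → Cond n
    ∀c ∃c       : Cond (suc n) → Cond n

  _⇔c_ : ∀ {n} → Cond n → Cond n → Cond n
  φ ⇔c ψ = (φ ⇒c ψ) ∧c (ψ ⇒c φ)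

  ext : ∀ {n} → Carrier D → (Fin n → Carrier D) → Fin (suc n) → Carrier D
  ext d ρ zero = d
  ext d ρ (suc i) = ρ i

  mutual
    ⟦_⟧ : ∀ {n s} → DTerm n s → (Fin n → Carrier D) → (ℕ → Carrier D) → Carrier s
    ⟦ lvar i ⟧ ρ ν = ρ i
    ⟦ flex v ⟧ ρ ν = ν v
    ⟦ fun f as ⟧ ρ ν = apply f (⟦ as ⟧s ρ ν)
    ⟦_⟧s : ∀ {n ss} → DArgs n ss → (Fin n → Carrier D) → (ℕ → Carrier D) → All Carrier ss
    ⟦ [] ⟧s ρ ν = []
    ⟦ t ∷ as ⟧s ρ ν = ⟦ t ⟧ ρ ν ∷ ⟦ as ⟧s ρ ν

  Sat : ∀ {n} → (Fin n → Carrier D) → (ℕ → Carrier D) → Cond n → Set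
  Sat ρ ν (e ≐ e') = ⟦ e ⟧ ρ ν ≡ ⟦ e' ⟧ ρ ν
  Sat ρ ν tt = ⊤
  Sat ρ ν ff = ⊥
  Sat ρ ν (¬c φ) = ¬ Sat ρ ν φ
  Sat ρ ν (φ ∧c ψ) = Sat ρ ν φ × Sat ρ ν ψ
  Sat ρ ν (φ ∨c ψ) = Sat ρ ν φ ⊎ Sat ρ ν ψ
  Sat ρ ν (φ ⇒c ψ) = Sat ρ ν φ → Sat ρ ν ψ
  Sat ρ ν (∀c φ) = ∀ d → Sat (ext d ρ) ν φ
  Sat ρ ν (∃c φ) = Σ (Carrier D) λ d → Sat (ext d ρ) ν φ

  noLVars : Fin 0 → Carrier D
  noLVars ()

  Valid : Cond 0 → Set
  Valid φ = ∀ (ν : ℕ → Carrier D) → Sat noLVars ν φ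

  InCs : Cond 0 → Set
  InCs φ = ¬ Valid (φ ⇔c ff)

  EvalMap : Set
  EvalMap = ℕ → Maybe (DTerm 0 D)

  IsEvalMap : EvalMap → Set
  IsEvalMap σ = ∀ v → σ v ≡ nothing ⊎ Σ (GTerm D) λ g → σ v ≡ just (emb g)

  -- σ(v) ∈ DataVal  (as opposed to σ(v) = v)
  Defined : EvalMap → ℕ → Set
  Defined σ v = Σ (DTerm 0 D) λ t → σ v ≡ just t

  Undefined : EvalMap → ℕ → Set
  Undefined σ v = σ v ≡ nothing

  _[_/_] : EvalMap → DTerm 0 D → ℕ → EvalMap
  (σ [ t / v ]) w with w ≟ℕ v
  ... | yes _ = just t
  ... | no  _ = σ w

  lookupσ : ∀ {n} → EvalMap → ℕ → DTerm n D
  lookupσ σ v with σ v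
  ... | nothing = flex v
  ... | just t  = wk t

  mutual
    σD : ∀ {n s} → EvalMap → DTerm n s → DTerm n s
    σD σ (lvar i) = lvar i
    σD σ (flex v) = lookupσ σ v
    σD σ (fun f as) = fun f (σDs σ as)
    σDs : ∀ {n ss} → EvalMap → DArgs n ss → DArgs n ss
    σDs σ [] = []
    σDs σ (t ∷ as) = σD σ t ∷ σDs σ as

  σV : ∀ {k} → EvalMap → Vec (DTerm 0 D) k → Vec (DTerm 0 D) k
  σV σ [] = []
  σV σ (e ∷ es) = σD σ e ∷ σV σ es

  σC : ∀ {n} → EvalMap → Cond n → Cond n
  σC σ (e ≐ e') = σD σ e ≐ σD σ e'
  σC σ tt = tt
  σC σ ff = ff
  σC σ (¬c φ) = ¬c σC σ φ
  σC σ (φ ∧c ψ) = σC σ φ ∧c σC σ ψ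
  σC σ (φ ∨c ψ) = σC σ φ ∨c σC σ ψ
  σC σ (φ ⇒c ψ) = σC σ φ ⇒c σC σ ψ
  σC σ (∀c φ) = ∀c (σC σ φ)
  σC σ (∃c φ) = ∃c (σC σ φ)

  data Action : Set where
    act  : A → Action
    dact : A → ∀ {k} → Vec (DTerm 0 D) k → Action
    asg  : ℕ → DTerm 0 D → Action

  eqs : ∀ {k} → Vec (DTerm 0 D) k → Vec (DTerm 0 D) k → Cond 0
  eqs [] [] = tt
  eqs (e ∷ []) (e' ∷ []) = e ≐ e'
  eqs (e ∷ es@(_ ∷ _)) (e' ∷ es') = (e ≐ e') ∧c eqs es es'

  commCond : ∀ {k} → Cond 0 → Cond 0 → Vec (DTerm 0 D) k → Vec (DTerm 0 D) k → Cond 0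
  commCond φ ψ [] [] = φ ∧c ψ
  commCond φ ψ es@(_ ∷ _) es' = φ ∧c ψ ∧c eqs es es'

  data _≃_ : Action → Action → Set where
    act≃  : ∀ {a} → act a ≃ act a
    dact≃ : ∀ {a k} {es es' : Vec (DTerm 0 D) k} → Valid (eqs es es') → dact a es ≃ dact a es'
    asg≃  : ∀ {v e e'} → Valid (e ≐ e') → asg v e ≃ asg v e'

  infixl 6 _+_
  infixl 7 _·_
  data Proc : Set where
    δ ε    : Proc
    ⌜_⌝    : Action → Proc
    _+_ _·_ _*_ _∥_ _⌊⌊_ _∣_ : Proc → Proc → Proc
    ∂      : Subset nA → Proc → Proc
    _:→_   : Cond 0 → Proc → Proc
    V      : EvalMap → Proc → Proc

  Passes : Subset nA → Action → Set
  Passes H (act a) = a ∉ H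
  Passes H (dact a es) = a ∉ H
  Passes H (asg v e) = ⊤

  data _↓[_] : Proc → Cond 0 → Set where
    ε↓   : InCs tt → ε ↓[ tt ]
    +ˡ↓  : ∀ {x y φ} → x ↓[ φ ] → (x + y) ↓[ φ ]
    +ʳ↓  : ∀ {x y φ} → x ↓[ φ ] → (y + x) ↓[ φ ]
    ·↓   : ∀ {x y φ ψ} → x ↓[ φ ] → y ↓[ ψ ] → InCs (φ ∧c ψ) → (x · y) ↓[ φ ∧c ψ ]
    *↓   : ∀ {x y φ} → y ↓[ φ ] → (x * y) ↓[ φ ]
    :→↓  : ∀ {x φ ψ} → x ↓[ φ ] → InCs (φ ∧c ψ) → (ψ :→ x) ↓[ φ ∧c ψ ]
    ∥↓   : ∀ {x y φ ψ} → x ↓[ φ ] → y ↓[ ψ ] → InCs (φ ∧c ψ) → (x ∥ y) ↓[ φ ∧c ψ ]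
    ∂↓   : ∀ {H x φ} → x ↓[ φ ] → ∂ H x ↓[ φ ]
    V↓   : ∀ {σ x φ} → x ↓[ φ ] → InCs (σC σ φ) → V σ x ↓[ σC σ φ ]

  data _—[_,_]→_ : Proc → Cond 0 → Action → Proc → Set where
    act→  : ∀ {α} → InCs tt → ⌜ α ⌝ —[ tt , α ]→ ε
    +ˡ→   : ∀ {x y φ α x'} → x —[ φ , α ]→ x' → (x + y) —[ φ , α ]→ x'
    +ʳ→   : ∀ {x y φ α x'} → x —[ φ , α ]→ x' → (y + x) —[ φ , α ]→ x'
    ·ʳ→   : ∀ {x y y' φ ψ α} → x ↓[ φ ] → y —[ ψ , α ]→ y' → InCs (φ ∧c ψ) →
            (x · y) —[ φ ∧c ψ , α ]→ y'
    ·ˡ→   : ∀ {x y x' φ α} → x —[ φ , α ]→ x' → (x · y) —[ φ , α ]→ (x' · y)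
    *ʳ→   : ∀ {x y y' φ α} → y —[ φ , α ]→ y' → (x * y) —[ φ , α ]→ y'
    *ˡ→   : ∀ {x y x' φ α} → x —[ φ , α ]→ x' → (x * y) —[ φ , α ]→ (x' · (x * y))
    :→→   : ∀ {x x' φ ψ α} → x —[ φ , α ]→ x' → InCs (φ ∧c ψ) → (ψ :→ x) —[ φ ∧c ψ , α ]→ x'
    ∥ˡ→   : ∀ {x y x' φ α} → x —[ φ , α ]→ x' → (x ∥ y) —[ φ , α ]→ (x' ∥ y)
    ∥ʳ→   : ∀ {x y y' φ α} → y —[ φ , α ]→ y' → (x ∥ y) —[ φ , α ]→ (x ∥ y')
    ∥c→   : ∀ {x y x' y' φ ψ a b c} → x —[ φ , act a ]→ x' → y —[ ψ , act b ]→ y' →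
            γ (just a) (just b) ≡ just c → InCs (φ ∧c ψ) →
            (x ∥ y) —[ φ ∧c ψ , act c ]→ (x' ∥ y')
    ∣c→   : ∀ {x y x' y' φ ψ a b c} → x —[ φ , act a ]→ x' → y —[ ψ , act b ]→ y' →
            γ (just a) (just b) ≡ just c → InCs (φ ∧c ψ) →
            (x ∣ y) —[ φ ∧c ψ , act c ]→ (x' ∥ y')
    ∥cd→  : ∀ {x y x' y' φ ψ a b c k} {es es' : Vec (DTerm 0 D) k} →
            x —[ φ , dact a es ]→ x' → y —[ ψ , dact b es' ]→ y' →
            γ (just a) (just b) ≡ just c → InCs (commCond φ ψ es es') →
            (x ∥ y) —[ commCond φ ψ es es' , dact c es ]→ (x' ∥ y')
    ∣cd→  : ∀ {x y x' y' φ ψ a b c k} {es es' : Vec (DTerm 0 D) k} →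
            x —[ φ , dact a es ]→ x' → y —[ ψ , dact b es' ]→ y' →
            γ (just a) (just b) ≡ just c → InCs (commCond φ ψ es es') →
            (x ∣ y) —[ commCond φ ψ es es' , dact c es ]→ (x' ∥ y')
    ⌊⌊→   : ∀ {x y x' φ α} → x —[ φ , α ]→ x' → (x ⌊⌊ y) —[ φ , α ]→ (x' ∥ y)
    ∂→    : ∀ {H x x' φ α} → x —[ φ , α ]→ x' → Passes H α → ∂ H x —[ φ , α ]→ ∂ H x'
    Va→   : ∀ {σ x x' φ a} → x —[ φ , act a ]→ x' → InCs (σC σ φ) →
            V σ x —[ σC σ φ , act a ]→ V σ x'
    Vd→   : ∀ {σ x x' φ a k} {es : Vec (DTerm 0 D) k} → x —[ φ , dact a es ]→ x' →
            InCs (σC σ φ) → V σ x —[ σC σ φ , dact a (σV σ es) ]→ V σ x'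
    Vdef→ : ∀ {σ x x' φ v e} → x —[ φ , asg v e ]→ x' → Defined σ v → InCs (σC σ φ) →
            V σ x —[ σC σ φ , asg v (σD σ e) ]→ V (σ [ σD σ e / v ]) x'
    Vund→ : ∀ {σ x x' φ v e} → x —[ φ , asg v e ]→ x' → Undefined σ v → InCs (σC σ φ) →
            V σ x —[ σC σ φ , asg v (σD σ e) ]→ V σ x'

  ⋁ : List (Cond 0) → Cond 0
  ⋁ [] = ff
  ⋁ (ψ ∷ Ψ) = ψ ∨c ⋁ Ψ

  record IsBisimulation (R : Proc → Proc → Set) : Set where
    field
      stepˡ : ∀ {p q φ α p'} → R p q → p —[ φ , α ]→ p' →
              Σ (List (Cond 0)) λ Ψ → All InCs Ψ × Valid (φ ⇒c ⋁ Ψ) ×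
                All (λ ψ → Σ Action λ α' → α ≃ α' × Σ Proc λ q' → q —[ ψ , α' ]→ q' × R p' q') Ψ
      stepʳ : ∀ {p q φ α q'} → R p q → q —[ φ , α ]→ q' →
              Σ (List (Cond 0)) λ Ψ → All InCs Ψ × Valid (φ ⇒c ⋁ Ψ) ×
                All (λ ψ → Σ Action λ α' → α ≃ α' × Σ Proc λ p' → p —[ ψ , α' ]→ p' × R p' q') Ψ
      termˡ : ∀ {p q φ} → R p q → p ↓[ φ ] →
              Σ (List (Cond 0)) λ Ψ → All InCs Ψ × Valid (φ ⇒c ⋁ Ψ) × All (λ ψ → q ↓[ ψ ]) Ψ
      termʳ : ∀ {p q φ} → R p q → q ↓[ φ ] →
              Σ (List (Cond 0)) λ Ψ → All InCs Ψ × Valid (φ ⇒c ⋁ Ψ) × All (λ ψ → p ↓[ ψ ]) Ψ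

  infix 3 _↔_
  _↔_ : Proc → Proc → Set₁
  p ↔ q = Σ (Proc → Proc → Set) λ R → IsBisimulation R × R p q

-- The congruence closure of a union of bisimulations, where V σ may also be related to V σ'
-- for evaluation maps σ, σ' that assign equal values, is again a bisimulation.  A transition of
-- a compound term is matched by combining the covers Ψ₁, Ψ₂ that the components provide:
-- conjunctions ψ₁ ∧ ψ₂ cover φ₁ ∧ φ₂, and the unsatisfiable ones, which cover nothing, are
-- discarded; since membership in 𝒞ˢ is undecidable, discarding them uses excluded middle.
-- Under V σ a cover of φ turns into a cover of σ(φ), because σ(φ) holds at a valuation ν iff φ
-- holds at ν updated by σ.  Matching an assignment v := e by v := e' with e = e' updates σ to
-- different but equivalent maps, which is why the closure must relate V σ to V σ'.
module Submission where

open import Defs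
open import Axiom.ExcludedMiddle using (ExcludedMiddle)
open import Data.Empty using (⊥-elim)
open import Data.Fin using (Fin)
open import Data.Fin.Subset using (Subset)
open import Data.List using (List; []; _∷_; map; cartesianProductWith)
open import Data.List.Relation.Unary.All as All using (All; []; _∷_)
open import Data.List.Relation.Unary.Any as Any using (Any; here; there)
open import Data.List.Relation.Unary.Any.Properties using (map⁺; cartesianProductWith⁺)
open import Data.Maybe using (just; nothing)
open import Data.Maybe.Relation.Binary.Pointwise as Maybe using (just-inv; nothing-inv)
open import Data.Nat using (ℕ) renaming (_≟_ to _≟ℕ_)
open import Data.Product using (_×_; Σ; _,_; proj₁; proj₂)
open import Data.Product.Function.NonDependent.Propositional using (_×-⇔_)
open import Data.Sum using (_⊎_; inj₁; inj₂)
open import Data.Sum.Function.Propositional using (_⊎-⇔_)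
open import Data.Unit using () renaming (tt to ⋆)
open import Data.Vec using (Vec; []; _∷_)
open import Data.Vec.Relation.Binary.Pointwise.Inductive as Vec using (Pointwise; []; _∷_)
open import Function using (id; flip)
open import Function.Bundles using (_⇔_; mk⇔; Equivalence)
open import Function.Construct.Identity using (⇔-id)
open import Function.Related.TypeIsomorphisms using (→-cong-⇔; ¬-cong-⇔)
open import Level using (0ℓ)
open import Relation.Binary.PropositionalEquality
  using (_≡_; _≗_; refl; sym; trans; cong; cong₂; subst; module ≡-Reasoning)
open import Relation.Nullary using (yes; no)

open Equivalence using (to; from)

module Congruence (S : Setting) (em : ExcludedMiddle 0ℓ) where
  open Setting S
  open Signature sig
  open Algebra 𝔇
  open Sem S

  Valuation : Set
  Valuation = ℕ → Carrier D

  infix 4 _⊨_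
  _⊨_ : Valuation → Cond 0 → Set
  ν ⊨ φ = Sat noLVars ν φ

  ⟦_⟧₀ : DTerm 0 D → Valuation → Carrier D
  ⟦ e ⟧₀ ν = ⟦ e ⟧ noLVars ν

  satisfiable⇒InCs : ∀ {ν φ} → ν ⊨ φ → InCs φ
  satisfiable⇒InCs {ν} s valid = proj₁ (valid ν) s

  ⊨⋁⇒Any : ∀ {ν Ψ} → ν ⊨ ⋁ Ψ → Any (ν ⊨_) Ψ
  ⊨⋁⇒Any {Ψ = _ ∷ _} (inj₁ s) = here s
  ⊨⋁⇒Any {Ψ = _ ∷ _} (inj₂ s) = there (⊨⋁⇒Any s)

  mutual
    ⟦wk⟧ : ∀ {n s} (t : DTerm 0 s) (ρ : Fin n → Carrier D) ν → ⟦ wk t ⟧ ρ ν ≡ ⟦ t ⟧ noLVars ν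
    ⟦wk⟧ (lvar ()) ρ ν
    ⟦wk⟧ (flex v) ρ ν = refl
    ⟦wk⟧ (fun f as) ρ ν = cong (apply f) (⟦wks⟧ as ρ ν)

    ⟦wks⟧ : ∀ {n ss} (as : DArgs 0 ss) (ρ : Fin n → Carrier D) ν → ⟦ wks as ⟧s ρ ν ≡ ⟦ as ⟧s noLVars ν
    ⟦wks⟧ [] ρ ν = refl
    ⟦wks⟧ (t ∷ as) ρ ν = cong₂ _∷_ (⟦wk⟧ t ρ ν) (⟦wks⟧ as ρ ν)

  mutual
    ⟦⟧-cong : ∀ {n s} (e : DTerm n s) ρ {ν μ} → ν ≗ μ → ⟦ e ⟧ ρ ν ≡ ⟦ e ⟧ ρ μ
    ⟦⟧-cong (lvar i) ρ ν≗μ = refl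
    ⟦⟧-cong (flex v) ρ ν≗μ = ν≗μ v
    ⟦⟧-cong (fun f as) ρ ν≗μ = cong (apply f) (⟦⟧s-cong as ρ ν≗μ)

    ⟦⟧s-cong : ∀ {n ss} (as : DArgs n ss) ρ {ν μ} → ν ≗ μ → ⟦ as ⟧s ρ ν ≡ ⟦ as ⟧s ρ μ
    ⟦⟧s-cong [] ρ ν≗μ = refl
    ⟦⟧s-cong (t ∷ as) ρ ν≗μ = cong₂ _∷_ (⟦⟧-cong t ρ ν≗μ) (⟦⟧s-cong as ρ ν≗μ)

  _∙_ : EvalMap → Valuation → Valuation
  (σ ∙ ν) v with σ v
  ... | nothing = ν v
  ... | just t  = ⟦ t ⟧₀ ν

  ⟦lookupσ⟧ : ∀ {n} σ (ρ : Fin n → Carrier D) ν v → ⟦ lookupσ σ v ⟧ ρ ν ≡ (σ ∙ ν) v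
  ⟦lookupσ⟧ σ ρ ν v with σ v
  ... | nothing = refl
  ... | just t  = ⟦wk⟧ t ρ ν

  mutual
    ⟦σD⟧ : ∀ {n s} σ (e : DTerm n s) ρ ν → ⟦ σD σ e ⟧ ρ ν ≡ ⟦ e ⟧ ρ (σ ∙ ν)
    ⟦σD⟧ σ (lvar i) ρ ν = refl
    ⟦σD⟧ σ (flex v) ρ ν = ⟦lookupσ⟧ σ ρ ν v
    ⟦σD⟧ σ (fun f as) ρ ν = cong (apply f) (⟦σDs⟧ σ as ρ ν)

    ⟦σDs⟧ : ∀ {n ss} σ (as : DArgs n ss) ρ ν → ⟦ σDs σ as ⟧s ρ ν ≡ ⟦ as ⟧s ρ (σ ∙ ν)
    ⟦σDs⟧ σ [] ρ ν = refl
    ⟦σDs⟧ σ (t ∷ as) ρ ν = cong₂ _∷_ (⟦σD⟧ σ t ρ ν) (⟦σDs⟧ σ as ρ ν)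

  ⟦σD⟧-≗ : ∀ {n s} σ (e : DTerm n s) ρ {ν μ} → σ ∙ ν ≗ μ → ⟦ σD σ e ⟧ ρ ν ≡ ⟦ e ⟧ ρ μ
  ⟦σD⟧-≗ σ e ρ {ν} σν≗μ = trans (⟦σD⟧ σ e ρ ν) (⟦⟧-cong e ρ σν≗μ)

  Sat-σC : ∀ {n} σ (φ : Cond n) ρ {ν μ} → σ ∙ ν ≗ μ → Sat ρ ν (σC σ φ) ⇔ Sat ρ μ φ
  Sat-σC σ (e ≐ e') ρ h =
    mk⇔ (λ p → trans (sym ⟦e⟧) (trans p ⟦e'⟧)) (λ p → trans ⟦e⟧ (trans p (sym ⟦e'⟧)))
    where
    ⟦e⟧ = ⟦σD⟧-≗ σ e ρ h
    ⟦e'⟧ = ⟦σD⟧-≗ σ e' ρ h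
  Sat-σC σ tt ρ h = ⇔-id _
  Sat-σC σ ff ρ h = ⇔-id _
  Sat-σC σ (¬c φ) ρ h = ¬-cong-⇔ (Sat-σC σ φ ρ h)
  Sat-σC σ (φ ∧c ψ) ρ h = Sat-σC σ φ ρ h ×-⇔ Sat-σC σ ψ ρ h
  Sat-σC σ (φ ∨c ψ) ρ h = Sat-σC σ φ ρ h ⊎-⇔ Sat-σC σ ψ ρ h
  Sat-σC σ (φ ⇒c ψ) ρ h = →-cong-⇔ (Sat-σC σ φ ρ h) (Sat-σC σ ψ ρ h)
  Sat-σC σ (∀c φ) ρ h =
    mk⇔ (λ s d → to (Sat-σC σ φ (ext d ρ) h) (s d)) (λ s d → from (Sat-σC σ φ (ext d ρ) h) (s d))
  Sat-σC σ (∃c φ) ρ h =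
    mk⇔ (λ (d , s) → d , to (Sat-σC σ φ (ext d ρ) h) s) (λ (d , s) → d , from (Sat-σC σ φ (ext d ρ) h) s)

  EqualAt : Valuation → ∀ {k} → Vec (DTerm 0 D) k → Vec (DTerm 0 D) k → Set
  EqualAt ν = Pointwise (λ e f → ⟦ e ⟧₀ ν ≡ ⟦ f ⟧₀ ν)

  EqualAt-trans : ∀ {ν k} {es fs gs : Vec (DTerm 0 D) k} → EqualAt ν es fs → EqualAt ν fs gs → EqualAt ν es gs
  EqualAt-trans = Vec.trans trans

  EqualAt-sym : ∀ {ν k} {es fs : Vec (DTerm 0 D) k} → EqualAt ν es fs → EqualAt ν fs es
  EqualAt-sym = Vec.sym sym

  ⊨eqs : ∀ {ν k} (es fs : Vec (DTerm 0 D) k) → ν ⊨ eqs es fs ⇔ EqualAt ν es fs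
  ⊨eqs es fs = mk⇔ (sound es fs) complete
    where
    sound : ∀ {ν k} (es fs : Vec (DTerm 0 D) k) → ν ⊨ eqs es fs → EqualAt ν es fs
    sound [] [] _ = []
    sound (e ∷ []) (f ∷ []) e≡f = e≡f ∷ []
    sound (e ∷ es@(_ ∷ _)) (f ∷ fs) (e≡f , es≡fs) = e≡f ∷ sound es fs es≡fs

    complete : ∀ {ν k} {es fs : Vec (DTerm 0 D) k} → EqualAt ν es fs → ν ⊨ eqs es fs
    complete [] = ⋆
    complete (e≡f ∷ []) = e≡f
    complete (e≡f ∷ es≡fs@(_ ∷ _)) = e≡f , complete es≡fs

  ⊨commCond : ∀ {ν k φ ψ} (es es' : Vec (DTerm 0 D) k) →
              ν ⊨ commCond φ ψ es es' ⇔ (ν ⊨ φ × ν ⊨ ψ × EqualAt ν es es')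
  ⊨commCond [] [] = mk⇔ (λ (s , t) → s , t , []) (λ (s , t , _) → s , t)
  ⊨commCond es@(_ ∷ _) es'@(_ ∷ _) = ⇔-id _ ×-⇔ ⇔-id _ ×-⇔ ⊨eqs es es'

  infix 4 _≈σ_
  _≈σ_ : EvalMap → EvalMap → Set
  σ ≈σ σ' = ∀ v → Maybe.Pointwise (λ t t' → Valid (t ≐ t')) (σ v) (σ' v)

  ≈σ-refl : ∀ {σ} → σ ≈σ σ
  ≈σ-refl v = Maybe.refl (λ ν → refl)

  ≈σ-sym : ∀ {σ σ'} → σ ≈σ σ' → σ' ≈σ σ
  ≈σ-sym σ≈σ' v = Maybe.sym (λ t≐t' ν → sym (t≐t' ν)) (σ≈σ' v)

  ∙-cong : ∀ {σ σ'} → σ ≈σ σ' → ∀ ν → σ ∙ ν ≗ σ' ∙ ν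
  ∙-cong {σ} {σ'} σ≈σ' ν v with σ v | σ' v | σ≈σ' v
  ... | just _  | just _  | Maybe.just t≐t' = t≐t' ν
  ... | nothing | nothing | Maybe.nothing   = refl

  σD-cong : ∀ {σ σ'} e e' → σ ≈σ σ' → Valid (e ≐ e') → Valid (σD σ e ≐ σD σ' e')
  σD-cong {σ} {σ'} e e' σ≈σ' e≐e' ν = begin
    ⟦ σD σ e ⟧₀ ν        ≡⟨ ⟦σD⟧-≗ σ e noLVars (∙-cong σ≈σ' ν) ⟩
    ⟦ e ⟧₀ (σ' ∙ ν)      ≡⟨ e≐e' (σ' ∙ ν) ⟩
    ⟦ e' ⟧₀ (σ' ∙ ν)     ≡⟨ ⟦σD⟧ σ' e' noLVars ν ⟨
    ⟦ σD σ' e' ⟧₀ ν      ∎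
    where open ≡-Reasoning

  σV-cong : ∀ {σ σ' ν k} {es fs : Vec (DTerm 0 D) k} → σ ≈σ σ' →
            EqualAt (σ ∙ ν) es fs → EqualAt ν (σV σ es) (σV σ' fs)
  σV-cong σ≈σ' [] = []
  σV-cong {σ} {σ'} {ν} {es = e ∷ _} {f ∷ _} σ≈σ' (e≡f ∷ es≡fs) = head ∷ σV-cong σ≈σ' es≡fs
    where
    head : ⟦ σD σ e ⟧₀ ν ≡ ⟦ σD σ' f ⟧₀ ν
    head = begin
      ⟦ σD σ e ⟧₀ ν      ≡⟨ ⟦σD⟧ σ e noLVars ν ⟩
      ⟦ e ⟧₀ (σ ∙ ν)     ≡⟨ e≡f ⟩
      ⟦ f ⟧₀ (σ ∙ ν)     ≡⟨ ⟦⟧-cong f noLVars (∙-cong σ≈σ' ν) ⟩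
      ⟦ f ⟧₀ (σ' ∙ ν)    ≡⟨ ⟦σD⟧ σ' f noLVars ν ⟨
      ⟦ σD σ' f ⟧₀ ν     ∎
      where open ≡-Reasoning

  ≈σ-update : ∀ {σ σ' v} e e' → σ ≈σ σ' → Valid (e ≐ e') →
              σ [ σD σ e / v ] ≈σ σ' [ σD σ' e' / v ]
  ≈σ-update {v = v} e e' σ≈σ' e≐e' w with w ≟ℕ v
  ... | yes _ = Maybe.just (σD-cong e e' σ≈σ' e≐e')
  ... | no _  = σ≈σ' w

  Defined-cong : ∀ {σ σ' v} → σ ≈σ σ' → Defined σ v → Defined σ' v
  Defined-cong {σ' = σ'} {v} σ≈σ' (t , σv≡t) =
    let t' , σ'v≡t' , _ = just-inv (subst (λ m → Maybe.Pointwise _ m (σ' v)) σv≡t (σ≈σ' v)) in t' , σ'v≡t'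

  Undefined-cong : ∀ {σ σ' v} → σ ≈σ σ' → Undefined σ v → Undefined σ' v
  Undefined-cong {σ' = σ'} {v} σ≈σ' σv≡nothing =
    nothing-inv (subst (λ m → Maybe.Pointwise _ m (σ' v)) σv≡nothing (σ≈σ' v))

  Passes-cong : ∀ {H α α'} → α ≃ α' → Passes H α → Passes H α'
  Passes-cong act≃ = id
  Passes-cong (dact≃ _) = id
  Passes-cong (asg≃ _) = id

  Covering : Cond 0 → (Cond 0 → Set) → Set
  Covering χ Q = Σ (List (Cond 0)) λ Ψ → All InCs Ψ × Valid (χ ⇒c ⋁ Ψ) × All Q Ψ

  -- A record rather than Covering itself, so that χ and Q can be inferred from it.
  record Cover (χ : Cond 0) (Q : Cond 0 → Set) : Set where
    constructor ⟨_⟩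
    field covering : Covering χ Q
  open Cover

  mapCover : ∀ {χ} {Q Q' : Cond 0 → Set} → (∀ {ψ} → Q ψ → Q' ψ) → Cover χ Q → Cover χ Q'
  mapCover f ⟨ Ψ , satisfiable , covers , qs ⟩ = ⟨ Ψ , satisfiable , covers , All.map f qs ⟩

  record PreCover (χ : Cond 0) (P : Cond 0 → Set) : Set where
    constructor preCover
    field
      entries : List (Σ (Cond 0) P)
      covers  : ∀ ν → ν ⊨ χ → Any (λ e → ν ⊨ proj₁ e) entries

  toPreCover : ∀ {χ Q} → Cover χ Q → PreCover χ Q
  toPreCover ⟨ Ψ , _ , covers , qs ⟩ = preCover (All.toList qs) λ ν s → lift qs (⊨⋁⇒Any (covers ν s))
    where
    lift : ∀ {ν Q Ψ} (qs : All Q Ψ) → Any (ν ⊨_) Ψ → Any (λ e → ν ⊨ proj₁ e) (All.toList qs)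
    lift (_ ∷ _) (here s) = here s
    lift (_ ∷ qs) (there a) = there (lift qs a)

  prune : ∀ {χ Q} → PreCover χ (λ ψ → InCs ψ → Q ψ) → Cover χ Q
  prune {Q = Q} (preCover L covers) =
    let Ψ , satisfiable , qs , ⋁-intro = select L in
    ⟨ Ψ , satisfiable , (λ ν s → ⋁-intro ν (covers ν s)) , qs ⟩
    where
    select : (L : List (Σ (Cond 0) λ ψ → InCs ψ → Q ψ)) →
             Σ (List (Cond 0)) λ Ψ → All InCs Ψ × All Q Ψ ×
               (∀ ν → Any (λ e → ν ⊨ proj₁ e) L → ν ⊨ ⋁ Ψ)
    select [] = [] , [] , [] , λ _ ()
    select ((ψ , q) ∷ L) with em {InCs ψ} | select L
    ... | yes i | Ψ , is , qs , ⋁-intro =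
      ψ ∷ Ψ , i ∷ is , q i ∷ qs , λ { ν (here s) → inj₁ s ; ν (there a) → inj₂ (⋁-intro ν a) }
    ... | no ¬i | Ψ , is , qs , ⋁-intro =
      Ψ , is , qs , λ { ν (here s) → ⊥-elim (¬i (satisfiable⇒InCs s)) ; ν (there a) → ⋁-intro ν a }

  PreCover-map : ∀ {χ χ'} {P Q : Cond 0 → Set} (g : Cond 0 → Cond 0) → (∀ {ψ} → P ψ → Q (g ψ)) →
                 (∀ ν → ν ⊨ χ' → Σ Valuation λ μ → μ ⊨ χ × (∀ {ψ} → μ ⊨ ψ → ν ⊨ g ψ)) →
                 PreCover χ P → PreCover χ' Q
  PreCover-map g f pull (preCover L covers) =
    preCover (map (λ (ψ , p) → g ψ , f p) L) λ ν s →
      let μ , sμ , back = pull ν s in map⁺ (Any.map back (covers μ sμ))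

  PreCover-product : ∀ {χ χ₁ χ₂} {P₁ P₂ Q : Cond 0 → Set} →
                     (f : Σ (Cond 0) P₁ → Σ (Cond 0) P₂ → Σ (Cond 0) Q) →
                     (∀ ν → ν ⊨ χ → ν ⊨ χ₁ × ν ⊨ χ₂) →
                     (∀ ν e₁ e₂ → ν ⊨ χ → ν ⊨ proj₁ e₁ → ν ⊨ proj₁ e₂ → ν ⊨ proj₁ (f e₁ e₂)) →
                     PreCover χ₁ P₁ → PreCover χ₂ P₂ → PreCover χ Q
  PreCover-product f split joint (preCover L₁ covers₁) (preCover L₂ covers₂) =
    preCover (cartesianProductWith f L₁ L₂) λ ν s →
      cartesianProductWith⁺ f (joint ν _ _ s) (covers₁ ν (proj₁ (split ν s))) (covers₂ ν (proj₂ (split ν s)))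

  Cover-∧ : ∀ {χ₁ χ₂} {Q₁ Q₂ Q : Cond 0 → Set} →
            (∀ {ψ₁ ψ₂} → Q₁ ψ₁ → Q₂ ψ₂ → InCs (ψ₁ ∧c ψ₂) → Q (ψ₁ ∧c ψ₂)) →
            Cover χ₁ Q₁ → Cover χ₂ Q₂ → Cover (χ₁ ∧c χ₂) Q
  Cover-∧ f m₁ m₂ = prune (PreCover-product (λ (ψ₁ , q₁) (ψ₂ , q₂) → ψ₁ ∧c ψ₂ , f q₁ q₂)
    (λ _ s → s) (λ _ _ _ _ s₁ s₂ → s₁ , s₂) (toPreCover m₁) (toPreCover m₂))

  Cover-:→ : ∀ {χ φ} {P Q : Cond 0 → Set} → (∀ {ψ} → P ψ → InCs (ψ ∧c φ) → Q (ψ ∧c φ)) →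
             Cover χ P → Cover (χ ∧c φ) Q
  Cover-:→ f m = prune (PreCover-map (_∧c _) f (λ ν (s , t) → ν , s , λ sψ → sψ , t) (toPreCover m))

  Cover-σC : ∀ {χ σ σ'} {P Q : Cond 0 → Set} → σ ≈σ σ' →
             (∀ {ψ} → P ψ → InCs (σC σ' ψ) → Q (σC σ' ψ)) → Cover χ P → Cover (σC σ χ) Q
  Cover-σC {χ} {σ} {σ'} σ≈σ' f m = prune (PreCover-map (σC σ') f pull (toPreCover m))
    where
    pull : ∀ ν → ν ⊨ σC σ χ → Σ Valuation λ μ → μ ⊨ χ × (∀ {ψ} → μ ⊨ ψ → ν ⊨ σC σ' ψ)
    pull ν s = σ ∙ ν , to (Sat-σC σ χ noLVars (λ _ → refl)) s ,
               λ {ψ} sψ → from (Sat-σC σ' ψ noLVars (λ v → sym (∙-cong σ≈σ' ν v))) sψ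

  data Closure (B : Proc → Proc → Set) : Proc → Proc → Set where
    base     : ∀ {x y} → B x y → Closure B x y
    +-cong   : ∀ {x y x' y'} → Closure B x x' → Closure B y y' → Closure B (x + y) (x' + y')
    ·-cong   : ∀ {x y x' y'} → Closure B x x' → Closure B y y' → Closure B (x · y) (x' · y')
    *-cong   : ∀ {x y x' y'} → Closure B x x' → Closure B y y' → Closure B (x * y) (x' * y')
    ∥-cong   : ∀ {x y x' y'} → Closure B x x' → Closure B y y' → Closure B (x ∥ y) (x' ∥ y')
    ⌊⌊-cong  : ∀ {x y x' y'} → Closure B x x' → Closure B y y' → Closure B (x ⌊⌊ y) (x' ⌊⌊ y')
    ∣-cong   : ∀ {x y x' y'} → Closure B x x' → Closure B y y' → Closure B (x ∣ y) (x' ∣ y')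
    ∂-cong   : ∀ {H x x'} → Closure B x x' → Closure B (∂ H x) (∂ H x')
    :→-cong  : ∀ {φ x x'} → Closure B x x' → Closure B (φ :→ x) (φ :→ x')
    V-cong   : ∀ {σ σ' x x'} → σ ≈σ σ' → Closure B x x' → Closure B (V σ x) (V σ' x')

  Closure-flip : ∀ {B x y} → Closure B x y → Closure (flip B) y x
  Closure-flip (base b) = base b
  Closure-flip (+-cong c d) = +-cong (Closure-flip c) (Closure-flip d)
  Closure-flip (·-cong c d) = ·-cong (Closure-flip c) (Closure-flip d)
  Closure-flip (*-cong c d) = *-cong (Closure-flip c) (Closure-flip d)
  Closure-flip (∥-cong c d) = ∥-cong (Closure-flip c) (Closure-flip d)
  Closure-flip (⌊⌊-cong c d) = ⌊⌊-cong (Closure-flip c) (Closure-flip d)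
  Closure-flip (∣-cong c d) = ∣-cong (Closure-flip c) (Closure-flip d)
  Closure-flip (∂-cong c) = ∂-cong (Closure-flip c)
  Closure-flip (:→-cong c) = :→-cong (Closure-flip c)
  Closure-flip (V-cong σ≈σ' c) = V-cong (≈σ-sym σ≈σ') (Closure-flip c)

  CommRule : (Proc → Proc → Proc) → Set
  CommRule _⊕_ = ∀ {x y x' y' φ ψ a b c} → x —[ φ , act a ]→ x' → y —[ ψ , act b ]→ y' →
                 γ (just a) (just b) ≡ just c → InCs (φ ∧c ψ) →
                 (x ⊕ y) —[ φ ∧c ψ , act c ]→ (x' ∥ y')

  DataCommRule : (Proc → Proc → Proc) → Set
  DataCommRule _⊕_ = ∀ {x y x' y' φ ψ a b c k} {es es' : Vec (DTerm 0 D) k} →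
                     x —[ φ , dact a es ]→ x' → y —[ ψ , dact b es' ]→ y' →
                     γ (just a) (just b) ≡ just c → InCs (commCond φ ψ es es') →
                     (x ⊕ y) —[ commCond φ ψ es es' , dact c es ]→ (x' ∥ y')

  module Matching (B : Proc → Proc → Set) (isBisim : IsBisimulation B) where
    open IsBisimulation isBisim

    data Match (y : Proc) (α : Action) (x' : Proc) (ψ : Cond 0) : Set where
      match : ∀ {α' y'} → α ≃ α' → y —[ ψ , α' ]→ y' → Closure B x' y' → Match y α x' ψ

    liftMatch : ∀ {y y₂ x' x₂ α ψ} (C : Proc → Proc) →
                (∀ {χ α' y'} → y —[ χ , α' ]→ y' → y₂ —[ χ , α' ]→ C y') →
                (∀ {y'} → Closure B x' y' → Closure B x₂ (C y')) →
                Match y α x' ψ → Match y₂ α x₂ ψ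
    liftMatch C rule cl (match α≃α' t r) = match α≃α' (rule t) (cl r)

    communicate : ∀ {_⊕_ y₁ y₂ x₁ x₂ φ ψ a b c} → CommRule _⊕_ → γ (just a) (just b) ≡ just c →
                  Cover φ (Match y₁ (act a) x₁) → Cover ψ (Match y₂ (act b) x₂) →
                  Cover (φ ∧c ψ) (Match (y₁ ⊕ y₂) (act c) (x₁ ∥ x₂))
    communicate {_⊕_} {y₁} {y₂} {x₁} {x₂} {a = a} {b} {c} rule g m₁ m₂ =
      Cover-∧ combine m₁ m₂
      where
      combine : ∀ {ψ₁ ψ₂} → Match y₁ (act a) x₁ ψ₁ → Match y₂ (act b) x₂ ψ₂ →
                InCs (ψ₁ ∧c ψ₂) → Match (y₁ ⊕ y₂) (act c) (x₁ ∥ x₂) (ψ₁ ∧c ψ₂)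
      combine (match act≃ u₁ r₁) (match act≃ u₂ r₂) i = match act≃ (rule u₁ u₂ g i) (∥-cong r₁ r₂)

    communicateData : ∀ {_⊕_ y₁ y₂ x₁ x₂ φ ψ a b c k} {es es' : Vec (DTerm 0 D) k} →
                      DataCommRule _⊕_ → γ (just a) (just b) ≡ just c →
                      Cover φ (Match y₁ (dact a es) x₁) → Cover ψ (Match y₂ (dact b es') x₂) →
                      Cover (commCond φ ψ es es') (Match (y₁ ⊕ y₂) (dact c es) (x₁ ∥ x₂))
    communicateData {_⊕_} {y₁} {y₂} {x₁} {x₂} {φ} {ψ} {a} {b} {c} {es = es} {es'} rule g m₁ m₂ =
      prune (PreCover-product combine split joint (toPreCover m₁) (toPreCover m₂))
      where
      Result = λ χ → InCs χ → Match (y₁ ⊕ y₂) (dact c es) (x₁ ∥ x₂) χ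

      combine : Σ (Cond 0) (Match y₁ (dact a es) x₁) → Σ (Cond 0) (Match y₂ (dact b es') x₂) →
                Σ (Cond 0) Result
      combine (ψ₁ , match (dact≃ {es' = fs} es≐fs) u₁ r₁) (ψ₂ , match (dact≃ {es' = fs'} _) u₂ r₂) =
        commCond ψ₁ ψ₂ fs fs' , λ i → match (dact≃ es≐fs) (rule u₁ u₂ g i) (∥-cong r₁ r₂)

      split : ∀ ν → ν ⊨ commCond φ ψ es es' → ν ⊨ φ × ν ⊨ ψ
      split ν s = let sφ , sψ , _ = to (⊨commCond es es') s in sφ , sψ

      -- fs = es = es' = fs' at ν
      joint : ∀ ν e₁ e₂ → ν ⊨ commCond φ ψ es es' → ν ⊨ proj₁ e₁ → ν ⊨ proj₁ e₂ →
              ν ⊨ proj₁ (combine e₁ e₂)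
      joint ν (ψ₁ , match (dact≃ {es' = fs} es≐fs) _ _) (ψ₂ , match (dact≃ {es' = fs'} es'≐fs') _ _) s s₁ s₂ =
        from (⊨commCond fs fs') (s₁ , s₂ ,
          EqualAt-trans (EqualAt-sym (to (⊨eqs es fs) (es≐fs ν)))
            (EqualAt-trans (proj₂ (proj₂ (to (⊨commCond es es') s))) (to (⊨eqs es' fs') (es'≐fs' ν))))

    terminates : ∀ {x y φ} → Closure B x y → x ↓[ φ ] → Cover φ (y ↓[_])
    terminates (base b) t = ⟨ termˡ b t ⟩
    terminates (+-cong c d) (+ˡ↓ t) = mapCover +ˡ↓ (terminates c t)
    terminates (+-cong c d) (+ʳ↓ t) = mapCover +ʳ↓ (terminates d t)
    terminates (·-cong c d) (·↓ t u _) = Cover-∧ ·↓ (terminates c t) (terminates d u)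
    terminates (*-cong c d) (*↓ t) = mapCover *↓ (terminates d t)
    terminates (∥-cong c d) (∥↓ t u _) = Cover-∧ ∥↓ (terminates c t) (terminates d u)
    terminates (∂-cong c) (∂↓ t) = mapCover ∂↓ (terminates c t)
    terminates (:→-cong c) (:→↓ t _) = Cover-:→ :→↓ (terminates c t)
    terminates (V-cong σ≈σ' c) (V↓ t _) = Cover-σC σ≈σ' V↓ (terminates c t)

    stepsV : ∀ {σ σ' x x' φ α y} → σ ≈σ σ' →
             (∀ {φ α x₁} → x —[ φ , α ]→ x₁ → Cover φ (Match x' α x₁)) →
             V σ x —[ φ , α ]→ y → Cover φ (Match (V σ' x') α y)
    stepsV σ≈σ' steps (Va→ t _) = Cover-σC σ≈σ' (λ { (match act≃ u r) i →
      match act≃ (Va→ u i) (V-cong σ≈σ' r) }) (steps t)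
    stepsV {σ} σ≈σ' steps (Vd→ t _) = Cover-σC σ≈σ' (λ { (match (dact≃ es≐fs) u r) i →
      match (dact≃ λ ν → from (⊨eqs _ _) (σV-cong σ≈σ' (to (⊨eqs _ _) (es≐fs (σ ∙ ν)))))
            (Vd→ u i) (V-cong σ≈σ' r) }) (steps t)
    stepsV σ≈σ' steps (Vdef→ t d _) = Cover-σC σ≈σ' (λ { (match (asg≃ {e = e} {e'} e≐e') u r) i →
      match (asg≃ (σD-cong e e' σ≈σ' e≐e')) (Vdef→ u (Defined-cong σ≈σ' d) i)
            (V-cong (≈σ-update e e' σ≈σ' e≐e') r) }) (steps t)
    stepsV σ≈σ' steps (Vund→ t d _) = Cover-σC σ≈σ' (λ { (match (asg≃ {e = e} {e'} e≐e') u r) i →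
      match (asg≃ (σD-cong e e' σ≈σ' e≐e')) (Vund→ u (Undefined-cong σ≈σ' d) i)
            (V-cong σ≈σ' r) }) (steps t)

    steps : ∀ {x y φ α x'} → Closure B x y → x —[ φ , α ]→ x' → Cover φ (Match y α x')
    steps (base b) t = mapCover (λ (_ , α≃α' , _ , u , r) → match α≃α' u (base r)) ⟨ stepˡ b t ⟩
    steps (+-cong c d) (+ˡ→ t) = mapCover (liftMatch id +ˡ→ id) (steps c t)
    steps (+-cong c d) (+ʳ→ t) = mapCover (liftMatch id +ʳ→ id) (steps d t)
    steps (·-cong c d) (·ˡ→ t) = mapCover (liftMatch (_· _) ·ˡ→ (λ r → ·-cong r d)) (steps c t)
    steps (·-cong c d) (·ʳ→ t u _) =
      Cover-∧ (λ { t' (match α≃α' u' r) i → match α≃α' (·ʳ→ t' u' i) r }) (terminates c t) (steps d u)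
    steps (*-cong c d) (*ʳ→ t) = mapCover (liftMatch id *ʳ→ id) (steps d t)
    steps (*-cong c d) (*ˡ→ t) = mapCover (liftMatch (_· _) *ˡ→ (λ r → ·-cong r (*-cong c d))) (steps c t)
    steps (:→-cong c) (:→→ t _) = Cover-:→ (λ { (match α≃α' u r) i → match α≃α' (:→→ u i) r }) (steps c t)
    steps (∥-cong c d) (∥ˡ→ t) = mapCover (liftMatch (_∥ _) ∥ˡ→ (λ r → ∥-cong r d)) (steps c t)
    steps (∥-cong c d) (∥ʳ→ t) = mapCover (liftMatch (_ ∥_) ∥ʳ→ (∥-cong c)) (steps d t)
    steps (∥-cong c d) (∥c→ t u g _) = communicate ∥c→ g (steps c t) (steps d u)
    steps (∥-cong c d) (∥cd→ t u g _) = communicateData ∥cd→ g (steps c t) (steps d u)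
    steps (⌊⌊-cong c d) (⌊⌊→ t) = mapCover (liftMatch (_∥ _) ⌊⌊→ (λ r → ∥-cong r d)) (steps c t)
    steps (∣-cong c d) (∣c→ t u g _) = communicate ∣c→ g (steps c t) (steps d u)
    steps (∣-cong c d) (∣cd→ t u g _) = communicateData ∣cd→ g (steps c t) (steps d u)
    steps (∂-cong c) (∂→ t p) =
      mapCover (λ { (match α≃α' u r) → match α≃α' (∂→ u (Passes-cong α≃α' p)) (∂-cong r) }) (steps c t)
    steps (V-cong σ≈σ' c) t = stepsV σ≈σ' (steps c) t

  flip-isBisimulation : ∀ {B} → IsBisimulation B → IsBisimulation (flip B)
  flip-isBisimulation isBisim = record { stepˡ = stepʳ ; stepʳ = stepˡ ; termˡ = termʳ ; termʳ = termˡ }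
    where open IsBisimulation isBisim

  ⊎-isBisimulation : ∀ {R₁ R₂} → IsBisimulation R₁ → IsBisimulation R₂ →
                     IsBisimulation (λ x y → R₁ x y ⊎ R₂ x y)
  ⊎-isBisimulation isBisim₁ isBisim₂ = record
    { stepˡ = λ { (inj₁ r) t → covering (mapCover (λ (α' , e , q , u , r') → α' , e , q , u , inj₁ r') ⟨ B₁.stepˡ r t ⟩)
                ; (inj₂ r) t → covering (mapCover (λ (α' , e , q , u , r') → α' , e , q , u , inj₂ r') ⟨ B₂.stepˡ r t ⟩) }
    ; stepʳ = λ { (inj₁ r) t → covering (mapCover (λ (α' , e , q , u , r') → α' , e , q , u , inj₁ r') ⟨ B₁.stepʳ r t ⟩)
                ; (inj₂ r) t → covering (mapCover (λ (α' , e , q , u , r') → α' , e , q , u , inj₂ r') ⟨ B₂.stepʳ r t ⟩) }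
    ; termˡ = λ { (inj₁ r) → B₁.termˡ r ; (inj₂ r) → B₂.termˡ r }
    ; termʳ = λ { (inj₁ r) → B₁.termʳ r ; (inj₂ r) → B₂.termʳ r }
    }
    where
    module B₁ = IsBisimulation isBisim₁
    module B₂ = IsBisimulation isBisim₂

  Closure-isBisimulation : ∀ {B} → IsBisimulation B → IsBisimulation (Closure B)
  Closure-isBisimulation {B} isBisim = record
    { stepˡ = λ r t → covering (mapCover (λ { (L.match e u r') → _ , e , _ , u , r' }) (L.steps r t))
    ; stepʳ = λ r t → covering (mapCover (λ { (R.match e u r') → _ , e , _ , u , Closure-flip r' })
                                         (R.steps (Closure-flip r) t))
    ; termˡ = λ r t → covering (L.terminates r t)
    ; termʳ = λ r t → covering (R.terminates (Closure-flip r) t)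
    }
    where
    module L = Matching B isBisim
    module R = Matching (flip B) (flip-isBisimulation isBisim)

theorem1 : (S : Setting) → ExcludedMiddle 0ℓ →
  let open Setting S
      open Sem S
  in
  ∀ (p q p' q' : Proc) (φ : Cond 0) (H : Subset nA) (σ : EvalMap) →
  IsEvalMap σ → p ↔ p' → q ↔ q' →
  ((p + q ↔ p' + q') × (p · q ↔ p' · q') × (p * q ↔ p' * q') ×
   (φ :→ p ↔ φ :→ p') × (p ∥ q ↔ p' ∥ q') × (p ⌊⌊ q ↔ p' ⌊⌊ q') ×
   (p ∣ q ↔ p' ∣ q') × (∂ H p ↔ ∂ H p') × (V σ p ↔ V σ p'))
-- The congruence argument does not need σ to be a genuine evaluation map.
theorem1 S em p q p' q' φ H σ _ (R₁ , isBisim₁ , p~p') (R₂ , isBisim₂ , q~q') =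
  bisimilar (+-cong l r) , bisimilar (·-cong l r) , bisimilar (*-cong l r) ,
  bisimilar (:→-cong l) , bisimilar (∥-cong l r) , bisimilar (⌊⌊-cong l r) ,
  bisimilar (∣-cong l r) , bisimilar (∂-cong l) , bisimilar (V-cong ≈σ-refl l)
  where
  open Sem S
  open Congruence S em
  B : Proc → Proc → Set
  B x y = R₁ x y ⊎ R₂ x y
  l : Closure B p p'
  l = base (inj₁ p~p')
  r : Closure B q q'
  r = base (inj₂ q~q')
  bisimilar : ∀ {x y} → Closure B x y → x ↔ y
  bisimilar c = Closure B , Closure-isBisimulation (⊎-isBisimulation isBisim₁ isBisim₂) , c
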